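{- Let $\mathcal F=\{B_1,\dots,B_t\}$ be a $(G,[k_1,\dots,k_t],\lambda)$ Hadamard partitioned difference family, assume that $G$ has a subgroup $H$ of index $2$, and set $s_i=|B_i\cap H|$ for $i=1,\dots,t$. Then $$s_1+\cdots+s_t=\lambda \quad\text{and}\quad 2s_1(k_1-s_1)+\cdots+2s_t(k_t-s_t)=\lambda^2.$$
   Context: Groups are finite, written additively (not necessarily abelian). For $B\subseteq G$, $\Delta B=\{x-y: x,y\in B, x\neq y\}$ as a multiset. A $(G,[k_1,\dots,k_t],\lambda)$ partitioned difference family (PDF) is a partition of $G$ into blocks $B_1,\dots,B_t$ with $|B_i|=k_i$ such that the multiset union of the $\Delta B_i$ covers every non-zero element of $G$ exactly $\lambda$ times. It is Hadamard (HPDF) if $|G|=2\lambda$. -}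

module Defs where

open import Data.Nat using (ℕ; zero; suc; _+_; _*_)
open import Data.Bool using (Bool; true; false; _∧_; if_then_else_; not)
open import Data.Fin using (Fin; zero; suc; _≟_)
open import Relation.Nullary.Decidable using (⌊_⌋)
open import Relation.Nullary using (¬_)
open import Relation.Binary.PropositionalEquality using (_≡_)
open import Algebra.Structures using (IsGroup)

count : ∀ {n} → (Fin n → Bool) → ℕ
count {zero}  P = 0
count {suc n} P = (if P zero then 1 else 0) + count (λ i → P (suc i))

sumFin : ∀ {t} → (Fin t → ℕ) → ℕ
sumFin {zero}  f = 0
sumFin {suc t} f = f zero + sumFin (λ i → f (suc i))

record FinGroup (n : ℕ) : Set where
  field
    _⊕_   : Fin n → Fin n → Fin n
    e     : Fin n
    ⊖_    : Fin n → Fin n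
    isGroup : IsGroup _≡_ _⊕_ e ⊖_

  _⊝_ : Fin n → Fin n → Fin n
  x ⊝ y = x ⊕ (⊖ y)

open FinGroup public

record IsSubgroup {n} (G : FinGroup n) (inH : Fin n → Bool) : Set where
  field
    e∈H : inH (e G) ≡ true
    ⊕∈H : ∀ x y → inH x ≡ true → inH y ≡ true → inH (_⊕_ G x y) ≡ true
    ⊖∈H : ∀ x → inH x ≡ true → inH (⊖_ G x) ≡ true

record IsIndex2Subgroup {n} (G : FinGroup n) (inH : Fin n → Bool) : Set where
  field
    subgroup : IsSubgroup G inH
    index2   : n ≡ 2 * count inH

-- Block membership: the partition {B_1,…,B_t} of G is encoded by the map
-- blk : G → Fin t sending each element to the index of the unique block
-- containing it, so B_i = { g | blk g = i }.
_∈B_ : ∀ {n t} → Fin n → (Fin n → Fin t) → Fin t → Bool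
(g ∈B blk) i = ⌊ blk g ≟ i ⌋

-- Number of times g occurs in the multiset union of the ΔB_i, i.e. the number
-- of ordered pairs (x , y) with x ≠ y in a common block and x - y = g.
diffCount : ∀ {n t} → FinGroup n → (Fin n → Fin t) → Fin n → ℕ
diffCount G blk g =
  sumFin (λ x → count (λ y →
    ⌊ blk x ≟ blk y ⌋ ∧ (not ⌊ x ≟ y ⌋ ∧ ⌊ _⊝_ G x y ≟ g ⌋)))

record IsPDF {n t} (G : FinGroup n) (blk : Fin n → Fin t)
             (k : Fin t → ℕ) (lam : ℕ) : Set where
  field
    sizes : ∀ i → count (λ g → (g ∈B blk) i) ≡ k i
    diffs : ∀ g → ¬ (g ≡ e G) → diffCount G blk g ≡ lam

record IsHPDF {n t} (G : FinGroup n) (blk : Fin n → Fin t)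
              (k : Fin t → ℕ) (lam : ℕ) : Set where
  field
    pdf      : IsPDF G blk k lam
    hadamard : n ≡ 2 * lam

{-# OPTIONS --safe #-}
-- Count the ordered pairs (x , y) of distinct elements lying in a common block with x - y ∉ H.
-- As H has index 2, x - y ∉ H exactly when one of x, y lies in H, so the block B_i contributes
-- 2 s_i (k_i - s_i) such pairs. On the other hand 0 ∈ H, so each of the |G ∖ H| = λ elements
-- outside H is a non-zero difference and occurs exactly λ times, giving λ² pairs.
-- The first identity is just Σ s_i = |H| = |G| / 2 = λ.
module Submission where

open import Defs
open import Algebra.Bundles using (Group)
import Algebra.Properties.Group as GroupProperties
open import Data.Bool using (Bool; true; false; _∧_; _∨_; not; _xor_; if_then_else_)
open import Data.Bool.Properties using (xor-same)
open import Data.Fin using (Fin; zero; suc; _≟_)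
open import Data.Fin.Permutation using (permutation)
open import Data.Nat using (ℕ; zero; suc; pred; _+_; _*_; _∸_; _^_; _≤_; z≤n; s≤s)
open import Data.Nat.Properties
  using (+-*-semiring; *-commutativeSemigroup; +-identityʳ; +-suc; *-identityʳ; *-comm; *-assoc;
         *-distribˡ-+; *-cancelˡ-≡; +-cancelˡ-≡; m≤n⇒m≤1+n; m+n∸m≡n; 1+n≰n)
open import Data.Nat.Tactic.RingSolver using (solve-∀)
open import Algebra.Properties.CommutativeSemigroup *-commutativeSemigroup using (x∙yz≈y∙xz)
open import Data.Product using (_×_; _,_)
open import Function using (_∘_)
open import Level using (0ℓ)
open import Relation.Binary.PropositionalEquality
open import Relation.Nullary using (yes; no; contradiction)
open import Relation.Nullary.Decidable using (⌊_⌋; ⌊⌋-map′)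
open import Algebra.Properties.Semiring.Sum +-*-semiring
  using (sum; sum-cong-≗; sum-replicate-zero; ∑-distrib-+; ∑-comm; *-distribˡ-sum; *-distribʳ-sum;
         sum-permute)

open ≡-Reasoning

𝟙 : Bool → ℕ
𝟙 b = if b then 1 else 0

𝟙-∧ : ∀ a b → 𝟙 (a ∧ b) ≡ 𝟙 a * 𝟙 b
𝟙-∧ true  b = sym (+-identityʳ (𝟙 b))
𝟙-∧ false b = refl

𝟙-split : ∀ a b → 𝟙 a ≡ 𝟙 (a ∧ b) + 𝟙 (a ∧ not b)
𝟙-split true  true  = refl
𝟙-split true  false = refl
𝟙-split false b     = refl

𝟙-xor : ∀ a b → 𝟙 (a xor b) ≡ 𝟙 a * 𝟙 (not b) + 𝟙 (not a) * 𝟙 b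
𝟙-xor true  true  = refl
𝟙-xor true  false = refl
𝟙-xor false true  = refl
𝟙-xor false false = refl

sumFin≡sum : ∀ {n} (f : Fin n → ℕ) → sumFin f ≡ sum f
sumFin≡sum {zero}  f = refl
sumFin≡sum {suc n} f = cong (f zero +_) (sumFin≡sum (f ∘ suc))

count≡sum : ∀ {n} (P : Fin n → Bool) → count P ≡ sum (𝟙 ∘ P)
count≡sum {zero}  P = refl
count≡sum {suc n} P = cong (𝟙 (P zero) +_) (count≡sum (P ∘ suc))

∑-δ : ∀ {n} (j : Fin n) (f : Fin n → ℕ) → sum (λ i → 𝟙 ⌊ j ≟ i ⌋ * f i) ≡ f j
∑-δ {suc n} zero    f = begin
  f zero + 0 + sum {n} (λ _ → 0) ≡⟨ cong₂ _+_ (+-identityʳ (f zero)) (sum-replicate-zero n) ⟩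
  f zero + 0                     ≡⟨ +-identityʳ (f zero) ⟩
  f zero                         ∎
∑-δ {suc n} (suc j) f = begin
  sum (λ i → 𝟙 ⌊ suc j ≟ suc i ⌋ * f (suc i))
    ≡⟨ sum-cong-≗ (λ i → cong (λ b → 𝟙 b * f (suc i)) (⌊⌋-map′ _ _ (j ≟ i))) ⟩
  sum (λ i → 𝟙 ⌊ j ≟ i ⌋ * f (suc i))
    ≡⟨ ∑-δ j (f ∘ suc) ⟩
  f (suc j) ∎

count-true : ∀ n → count {n} (λ _ → true) ≡ n
count-true zero    = refl
count-true (suc n) = cong suc (count-true n)

count≤n : ∀ {n} (P : Fin n → Bool) → count P ≤ n
count≤n {zero}  P = z≤n
count≤n {suc n} P with P zero
... | true  = s≤s (count≤n (P ∘ suc))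
... | false = m≤n⇒m≤1+n (count≤n (P ∘ suc))

count-split : ∀ {n} (R P : Fin n → Bool) →
              count R ≡ count (λ g → R g ∧ P g) + count (λ g → R g ∧ not (P g))
count-split {n} R P = begin
  count R
    ≡⟨ count≡sum R ⟩
  sum (𝟙 ∘ R)
    ≡⟨ sum-cong-≗ (λ g → 𝟙-split (R g) (P g)) ⟩
  sum (λ g → 𝟙 (R∧P g) + 𝟙 (R∧¬P g))
    ≡⟨ ∑-distrib-+ (𝟙 ∘ R∧P) (𝟙 ∘ R∧¬P) ⟩
  sum (𝟙 ∘ R∧P) + sum (𝟙 ∘ R∧¬P)
    ≡⟨ sym (cong₂ _+_ (count≡sum R∧P) (count≡sum R∧¬P)) ⟩
  count R∧P + count R∧¬P ∎
  where
  R∧P R∧¬P : Fin n → Bool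
  R∧P g  = R g ∧ P g
  R∧¬P g = R g ∧ not (P g)

count≡n⇒all : ∀ {n} (P : Fin n → Bool) → count P ≡ n → ∀ x → P x ≡ true
count≡n⇒all {suc n} P eq x with P zero in P₀
count≡n⇒all {suc n} P eq zero    | true  = P₀
count≡n⇒all {suc n} P eq (suc x) | true  = count≡n⇒all (P ∘ suc) (cong pred eq) x
count≡n⇒all {suc n} P eq x       | false = contradiction (subst (_≤ n) eq (count≤n (P ∘ suc))) 1+n≰n

count-∨ : ∀ {n} (P Q : Fin n → Bool) → (∀ x → P x ∧ Q x ≡ false) →
          count (λ x → P x ∨ Q x) ≡ count P + count Q
count-∨ {zero}  P Q disjoint = refl
count-∨ {suc n} P Q disjoint with P zero | Q zero | disjoint zero
... | true  | true  | ()
... | true  | false | _ = cong suc rest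
  where rest = count-∨ (P ∘ suc) (Q ∘ suc) (disjoint ∘ suc)
... | false | true  | _ = trans (cong suc rest) (sym (+-suc (count (P ∘ suc)) (count (Q ∘ suc))))
  where rest = count-∨ (P ∘ suc) (Q ∘ suc) (disjoint ∘ suc)
... | false | false | _ = count-∨ (P ∘ suc) (Q ∘ suc) (disjoint ∘ suc)

count-∘-inverse : ∀ {n} (P : Fin n → Bool) (f g : Fin n → Fin n) →
                  (∀ x → f (g x) ≡ x) → (∀ x → g (f x) ≡ x) → count (P ∘ f) ≡ count P
count-∘-inverse P f g f∘g g∘f = begin
  count (P ∘ f)    ≡⟨ count≡sum (P ∘ f) ⟩
  sum (𝟙 ∘ P ∘ f)  ≡⟨ sym (sum-permute (𝟙 ∘ P) (permutation f g f∘g g∘f)) ⟩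
  sum (𝟙 ∘ P)      ≡⟨ sym (count≡sum P) ⟩
  count P          ∎

blockCount : ∀ {n t} → (Fin n → Fin t) → (Fin n → Bool) → Fin t → ℕ
blockCount blk P i = count (λ g → (g ∈B blk) i ∧ P g)

⌊≟⌋-sym : ∀ {n} (a b : Fin n) → ⌊ a ≟ b ⌋ ≡ ⌊ b ≟ a ⌋
⌊≟⌋-sym a b with a ≟ b | b ≟ a
... | yes _   | yes _   = refl
... | no _    | no _    = refl
... | yes a≡b | no b≢a  = contradiction (sym a≡b) b≢a
... | no a≢b  | yes b≡a = contradiction (sym b≡a) a≢b

sum-𝟙*∘blk : ∀ {n t} (blk : Fin n → Fin t) (P : Fin n → Bool) (f : Fin t → ℕ) →
             sum (λ x → 𝟙 (P x) * f (blk x)) ≡ sum (λ i → blockCount blk P i * f i)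
sum-𝟙*∘blk blk P f = begin
  sum (λ x → 𝟙 (P x) * f (blk x))
    ≡⟨ sum-cong-≗ (λ x → sym (∑-δ (blk x) (λ i → 𝟙 (P x) * f i))) ⟩
  sum (λ x → sum (λ i → 𝟙 ((x ∈B blk) i) * (𝟙 (P x) * f i)))
    ≡⟨ ∑-comm (λ x i → 𝟙 ((x ∈B blk) i) * (𝟙 (P x) * f i)) ⟩
  sum (λ i → sum (λ x → 𝟙 ((x ∈B blk) i) * (𝟙 (P x) * f i)))
    ≡⟨ sum-cong-≗ (λ i → sum-cong-≗ (λ x → 𝟙*𝟙* ((x ∈B blk) i) (P x) (f i))) ⟩
  sum (λ i → sum (λ x → 𝟙 ((x ∈B blk) i ∧ P x) * f i))
    ≡⟨ sum-cong-≗ (λ i → sym (*-distribʳ-sum (f i) (λ x → 𝟙 ((x ∈B blk) i ∧ P x)))) ⟩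
  sum (λ i → sum (λ x → 𝟙 ((x ∈B blk) i ∧ P x)) * f i)
    ≡⟨ sum-cong-≗ (λ i → cong (_* f i) (sym (count≡sum (λ x → (x ∈B blk) i ∧ P x)))) ⟩
  sum (λ i → blockCount blk P i * f i) ∎
  where
  𝟙*𝟙* : ∀ a b c → 𝟙 a * (𝟙 b * c) ≡ 𝟙 (a ∧ b) * c
  𝟙*𝟙* a b c = trans (sym (*-assoc (𝟙 a) (𝟙 b) c)) (cong (_* c) (sym (𝟙-∧ a b)))

sum-blockCount : ∀ {n t} (blk : Fin n → Fin t) (P : Fin n → Bool) →
                 sum (blockCount blk P) ≡ count P
sum-blockCount blk P = begin
  sum (blockCount blk P)              ≡⟨ sum-cong-≗ (λ i → sym (*-identityʳ (blockCount blk P i))) ⟩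
  sum (λ i → blockCount blk P i * 1)  ≡⟨ sym (sum-𝟙*∘blk blk P (λ _ → 1)) ⟩
  sum (λ x → 𝟙 (P x) * 1)             ≡⟨ sum-cong-≗ (λ x → *-identityʳ (𝟙 (P x))) ⟩
  sum (𝟙 ∘ P)                         ≡⟨ sym (count≡sum P) ⟩
  count P                             ∎

blockSize∸blockCount : ∀ {n t} (blk : Fin n → Fin t) (P : Fin n → Bool) (i : Fin t) →
                       count (λ g → (g ∈B blk) i) ∸ blockCount blk P i ≡ blockCount blk (not ∘ P) i
blockSize∸blockCount blk P i =
  trans (cong (_∸ blockCount blk P i) (count-split (λ g → (g ∈B blk) i) P))
        (m+n∸m≡n (blockCount blk P i) (blockCount blk (not ∘ P) i))

∑∑-sameBlock : ∀ {n t} (blk : Fin n → Fin t) (P Q : Fin n → Bool) →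
               sum (λ x → sum (λ y → 𝟙 ⌊ blk x ≟ blk y ⌋ * (𝟙 (P x) * 𝟙 (Q y))))
               ≡ sum (λ i → blockCount blk P i * blockCount blk Q i)
∑∑-sameBlock blk P Q = trans (sum-cong-≗ inner) (sum-𝟙*∘blk blk P (blockCount blk Q))
  where
  inner : ∀ x → sum (λ y → 𝟙 ⌊ blk x ≟ blk y ⌋ * (𝟙 (P x) * 𝟙 (Q y)))
                ≡ 𝟙 (P x) * blockCount blk Q (blk x)
  inner x = begin
    sum (λ y → 𝟙 ⌊ blk x ≟ blk y ⌋ * (𝟙 (P x) * 𝟙 (Q y)))
      ≡⟨ sum-cong-≗ (λ y → x∙yz≈y∙xz (𝟙 ⌊ blk x ≟ blk y ⌋) (𝟙 (P x)) (𝟙 (Q y))) ⟩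
    sum (λ y → 𝟙 (P x) * (𝟙 ⌊ blk x ≟ blk y ⌋ * 𝟙 (Q y)))
      ≡⟨ sum-cong-≗ (λ y → cong (𝟙 (P x) *_) (swap-sameBlock y)) ⟩
    sum (λ y → 𝟙 (P x) * 𝟙 ((y ∈B blk) (blk x) ∧ Q y))
      ≡⟨ sym (*-distribˡ-sum (𝟙 (P x)) (λ y → 𝟙 ((y ∈B blk) (blk x) ∧ Q y))) ⟩
    𝟙 (P x) * sum (λ y → 𝟙 ((y ∈B blk) (blk x) ∧ Q y))
      ≡⟨ cong (𝟙 (P x) *_) (sym (count≡sum (λ y → (y ∈B blk) (blk x) ∧ Q y))) ⟩
    𝟙 (P x) * blockCount blk Q (blk x) ∎
    where
    swap-sameBlock : ∀ y → 𝟙 ⌊ blk x ≟ blk y ⌋ * 𝟙 (Q y) ≡ 𝟙 ((y ∈B blk) (blk x) ∧ Q y)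
    swap-sameBlock y = trans (cong (λ b → 𝟙 b * 𝟙 (Q y)) (⌊≟⌋-sym (blk x) (blk y)))
                             (sym (𝟙-∧ ((y ∈B blk) (blk x)) (Q y)))

∑∑-sameBlock-xor : ∀ {n t} (blk : Fin n → Fin t) (P : Fin n → Bool) →
                   sum (λ x → sum (λ y → 𝟙 ⌊ blk x ≟ blk y ⌋ * 𝟙 (P x xor P y)))
                   ≡ sum (λ i → 2 * blockCount blk P i * blockCount blk (not ∘ P) i)
∑∑-sameBlock-xor {n} {t} blk P = begin
  sum (λ x → sum (λ y → same x y * 𝟙 (P x xor P y)))
    ≡⟨ sum-cong-≗ (λ x → sum-cong-≗ (λ y → split x y)) ⟩
  sum (λ x → sum (λ y → in-out x y + out-in x y))
    ≡⟨ sum-cong-≗ (λ x → ∑-distrib-+ (in-out x) (out-in x)) ⟩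
  sum (λ x → sum (in-out x) + sum (out-in x))
    ≡⟨ ∑-distrib-+ (sum ∘ in-out) (sum ∘ out-in) ⟩
  sum (sum ∘ in-out) + sum (sum ∘ out-in)
    ≡⟨ cong₂ _+_ (∑∑-sameBlock blk P (not ∘ P)) (∑∑-sameBlock blk (not ∘ P) P) ⟩
  sum (λ i → s i * r i) + sum (λ i → r i * s i)
    ≡⟨ sym (∑-distrib-+ (λ i → s i * r i) (λ i → r i * s i)) ⟩
  sum (λ i → s i * r i + r i * s i)
    ≡⟨ sum-cong-≗ (λ i → double (s i) (r i)) ⟩
  sum (λ i → 2 * s i * r i) ∎
  where
  same : Fin n → Fin n → ℕ
  same x y = 𝟙 ⌊ blk x ≟ blk y ⌋
  in-out out-in : Fin n → Fin n → ℕ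
  in-out x y = same x y * (𝟙 (P x) * 𝟙 (not (P y)))
  out-in x y = same x y * (𝟙 (not (P x)) * 𝟙 (P y))
  s r : Fin t → ℕ
  s = blockCount blk P
  r = blockCount blk (not ∘ P)

  split : ∀ x y → same x y * 𝟙 (P x xor P y) ≡ in-out x y + out-in x y
  split x y = trans (cong (same x y *_) (𝟙-xor (P x) (P y)))
                    (*-distribˡ-+ (same x y) (𝟙 (P x) * 𝟙 (not (P y))) (𝟙 (not (P x)) * 𝟙 (P y)))

  double : ∀ a b → a * b + b * a ≡ 2 * a * b
  double a b = begin
    a * b + b * a        ≡⟨ cong (a * b +_) (*-comm b a) ⟩
    a * b + a * b        ≡⟨ cong (a * b +_) (sym (+-identityʳ (a * b))) ⟩
    2 * (a * b)          ≡⟨ sym (*-assoc 2 a b) ⟩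
    2 * a * b            ∎

∑-weighted-diffCount : ∀ {n t} (G : FinGroup n) (blk : Fin n → Fin t) (w : Fin n → ℕ) →
  sum (λ g → w g * diffCount G blk g)
  ≡ sum (λ x → sum (λ y → 𝟙 ⌊ blk x ≟ blk y ⌋ * (𝟙 (not ⌊ x ≟ y ⌋) * w (_⊝_ G x y))))
∑-weighted-diffCount {n} G blk w = begin
  sum (λ g → w g * diffCount G blk g)
    ≡⟨ sum-cong-≗ (λ g → cong (w g *_) (diffCount≡∑∑ g)) ⟩
  sum (λ g → w g * sum (λ x → sum (λ y → 𝟙 (pair x y g))))
    ≡⟨ sum-cong-≗ (λ g → distrib g) ⟩
  sum (λ g → sum (λ x → sum (λ y → w g * 𝟙 (pair x y g))))
    ≡⟨ ∑-comm (λ g x → sum (λ y → w g * 𝟙 (pair x y g))) ⟩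
  sum (λ x → sum (λ g → sum (λ y → w g * 𝟙 (pair x y g))))
    ≡⟨ sum-cong-≗ (λ x → ∑-comm (λ g y → w g * 𝟙 (pair x y g))) ⟩
  sum (λ x → sum (λ y → sum (λ g → w g * 𝟙 (pair x y g))))
    ≡⟨ sum-cong-≗ (λ x → sum-cong-≗ (λ y → sum-cong-≗ (λ g → reorder x y g))) ⟩
  sum (λ x → sum (λ y → sum (λ g → 𝟙 ⌊ _⊝_ G x y ≟ g ⌋ * weight x y g)))
    ≡⟨ sum-cong-≗ (λ x → sum-cong-≗ (λ y → ∑-δ (_⊝_ G x y) (weight x y))) ⟩
  sum (λ x → sum (λ y → weight x y (_⊝_ G x y))) ∎
  where
  weight : Fin n → Fin n → Fin n → ℕ
  weight x y g = 𝟙 ⌊ blk x ≟ blk y ⌋ * (𝟙 (not ⌊ x ≟ y ⌋) * w g)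

  pair : Fin n → Fin n → Fin n → Bool
  pair x y g = ⌊ blk x ≟ blk y ⌋ ∧ (not ⌊ x ≟ y ⌋ ∧ ⌊ _⊝_ G x y ≟ g ⌋)

  diffCount≡∑∑ : ∀ g → diffCount G blk g ≡ sum (λ x → sum (λ y → 𝟙 (pair x y g)))
  diffCount≡∑∑ g = trans (sumFin≡sum (λ x → count (λ y → pair x y g)))
                         (sum-cong-≗ (λ x → count≡sum (λ y → pair x y g)))

  distrib : ∀ g → w g * sum (λ x → sum (λ y → 𝟙 (pair x y g)))
                  ≡ sum (λ x → sum (λ y → w g * 𝟙 (pair x y g)))
  distrib g = trans (*-distribˡ-sum (w g) (λ x → sum (λ y → 𝟙 (pair x y g))))
                    (sum-cong-≗ (λ x → *-distribˡ-sum (w g) (λ y → 𝟙 (pair x y g))))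

  reorder : ∀ x y g → w g * 𝟙 (pair x y g) ≡ 𝟙 ⌊ _⊝_ G x y ≟ g ⌋ * weight x y g
  reorder x y g = begin
    w g * 𝟙 (a ∧ (b ∧ d))
      ≡⟨ cong (w g *_) (trans (𝟙-∧ a (b ∧ d)) (cong (𝟙 a *_) (𝟙-∧ b d))) ⟩
    w g * (𝟙 a * (𝟙 b * 𝟙 d))
      ≡⟨ rotate (w g) (𝟙 a) (𝟙 b) (𝟙 d) ⟩
    𝟙 d * (𝟙 a * (𝟙 b * w g)) ∎
    where
    a b d : Bool
    a = ⌊ blk x ≟ blk y ⌋
    b = not ⌊ x ≟ y ⌋
    d = ⌊ _⊝_ G x y ≟ g ⌋

    rotate : ∀ p q r u → p * (q * (r * u)) ≡ u * (q * (r * p))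
    rotate = solve-∀

module Index2Subgroup {n} (G : FinGroup n) {inH : Fin n → Bool} (H : IsIndex2Subgroup G inH) where
  open IsIndex2Subgroup H
  open IsSubgroup subgroup

  group : Group 0ℓ 0ℓ
  group = record { _≈_ = _≡_ ; _∙_ = _⊕_ G ; ε = e G ; _⁻¹ = ⊖_ G ; isGroup = isGroup G }

  open Group group using (_∙_; _⁻¹; _//_)
  open GroupProperties group using (//-rightDividesˡ; //-rightDividesʳ; \\-leftDividesʳ; ⁻¹-involutive)

  private
    absurd : ∀ {b} {A : Set} → b ≡ true → b ≡ false → A
    absurd refl ()

  //-closed : ∀ {x y} → inH x ≡ true → inH y ≡ true → inH (x // y) ≡ true
  //-closed x∈ y∈ = ⊕∈H _ _ x∈ (⊖∈H _ y∈)

  //-∈⇒∈ˡ : ∀ {x y} → inH (x // y) ≡ true → inH y ≡ true → inH x ≡ true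
  //-∈⇒∈ˡ {x} {y} x/y∈ y∈ = subst (λ z → inH z ≡ true) (//-rightDividesˡ y x) (⊕∈H _ _ x/y∈ y∈)

  //-∈⇒∈ʳ : ∀ {x y} → inH x ≡ true → inH (x // y) ≡ true → inH y ≡ true
  //-∈⇒∈ʳ {x} {y} x∈ x/y∈ = subst (λ z → inH z ≡ true) (⁻¹-involutive y) (⊖∈H _ y⁻¹∈)
    where
    y⁻¹∈ : inH (y ⁻¹) ≡ true
    y⁻¹∈ = subst (λ z → inH z ≡ true) (\\-leftDividesʳ x (y ⁻¹)) (⊕∈H _ _ (⊖∈H _ x∈) x/y∈)

  -- H and H + y are disjoint (y ∉ H) and together have 2 |H| = |G| elements, so they cover G.
  //-∉⇒∈ : ∀ {x y} → inH x ≡ false → inH y ≡ false → inH (x // y) ≡ true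
  //-∉⇒∈ {x} {y} x∉ y∉ = subst (λ b → b ∨ inH (x // y) ≡ true) x∉ (covered x)
    where
    disjoint : ∀ z → inH z ∧ inH (z // y) ≡ false
    disjoint z with inH z in z∈ | inH (z // y) in z/y∈
    ... | true  | true  = absurd (//-∈⇒∈ʳ z∈ z/y∈) y∉
    ... | true  | false = refl
    ... | false | _     = refl

    covered : ∀ z → inH z ∨ inH (z // y) ≡ true
    covered = count≡n⇒all (λ z → inH z ∨ inH (z // y)) (begin
      count (λ z → inH z ∨ inH (z // y))
        ≡⟨ count-∨ inH (λ z → inH (z // y)) disjoint ⟩
      count inH + count (λ z → inH (z // y))
        ≡⟨ cong (count inH +_) (count-∘-inverse inH (_// y) (_∙ y) (//-rightDividesʳ y)
                                                                     (//-rightDividesˡ y)) ⟩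
      count inH + count inH
        ≡⟨ cong (count inH +_) (sym (+-identityʳ (count inH))) ⟩
      2 * count inH
        ≡⟨ sym index2 ⟩
      n ∎)

  ∉H-//≡xor : ∀ x y → not (inH (x // y)) ≡ inH x xor inH y
  ∉H-//≡xor x y with inH x in x∈ | inH y in y∈ | inH (x // y) in x/y∈
  ... | true  | true  | true  = refl
  ... | true  | true  | false = absurd (//-closed x∈ y∈) x/y∈
  ... | true  | false | true  = absurd (//-∈⇒∈ʳ x∈ x/y∈) y∈
  ... | true  | false | false = refl
  ... | false | true  | true  = absurd (//-∈⇒∈ˡ x/y∈ y∈) x∈
  ... | false | true  | false = refl
  ... | false | false | true  = refl
  ... | false | false | false = absurd (//-∉⇒∈ x∈ y∈) x/y∈

  ∉H⇒≢ε : ∀ {g} → inH g ≡ false → g ≢ e G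
  ∉H⇒≢ε g∉ refl = absurd e∈H g∉

  count-∉H≡count-∈H : count (not ∘ inH) ≡ count inH
  count-∉H≡count-∈H = +-cancelˡ-≡ (count inH) _ _ (begin
    count inH + count (not ∘ inH) ≡⟨ sym (count-split (λ _ → true) inH) ⟩
    count {n} (λ _ → true)        ≡⟨ count-true n ⟩
    n                             ≡⟨ index2 ⟩
    count inH + (count inH + 0)   ≡⟨ cong (count inH +_) (+-identityʳ (count inH)) ⟩
    count inH + count inH         ∎)

  ∑-∉H-diffCount : ∀ {t} (blk : Fin n → Fin t) →
                   sum (λ g → 𝟙 (not (inH g)) * diffCount G blk g)
                   ≡ sum (λ i → 2 * blockCount blk inH i * blockCount blk (not ∘ inH) i)
  ∑-∉H-diffCount blk = begin
    sum (λ g → 𝟙 (not (inH g)) * diffCount G blk g)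
      ≡⟨ ∑-weighted-diffCount G blk (𝟙 ∘ not ∘ inH) ⟩
    sum (λ x → sum (λ y → 𝟙 ⌊ blk x ≟ blk y ⌋ * (𝟙 (not ⌊ x ≟ y ⌋) * 𝟙 (not (inH (x // y))))))
      ≡⟨ sum-cong-≗ (λ x → sum-cong-≗ (λ y → cong (𝟙 ⌊ blk x ≟ blk y ⌋ *_) (𝟙-≢-∉H≡𝟙-xor x y))) ⟩
    sum (λ x → sum (λ y → 𝟙 ⌊ blk x ≟ blk y ⌋ * 𝟙 (inH x xor inH y)))
      ≡⟨ ∑∑-sameBlock-xor blk inH ⟩
    sum (λ i → 2 * blockCount blk inH i * blockCount blk (not ∘ inH) i) ∎
    where
    𝟙-≢-∉H≡𝟙-xor : ∀ x y → 𝟙 (not ⌊ x ≟ y ⌋) * 𝟙 (not (inH (x // y))) ≡ 𝟙 (inH x xor inH y)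
    𝟙-≢-∉H≡𝟙-xor x y with x ≟ y
    ... | yes refl = cong 𝟙 (sym (xor-same (inH x)))
    ... | no _     = trans (+-identityʳ _) (cong 𝟙 (∉H-//≡xor x y))

  ∑-∉H-diffCount-PDF : ∀ {t} {blk : Fin n → Fin t} {k : Fin t → ℕ} {lam : ℕ} → IsPDF G blk k lam →
                       sum (λ g → 𝟙 (not (inH g)) * diffCount G blk g) ≡ count inH * lam
  ∑-∉H-diffCount-PDF {blk = blk} {lam = lam} pdf = begin
    sum (λ g → 𝟙 (not (inH g)) * diffCount G blk g)  ≡⟨ sum-cong-≗ weight∉H ⟩
    sum (λ g → 𝟙 (not (inH g)) * lam)                ≡⟨ sym (*-distribʳ-sum lam (𝟙 ∘ not ∘ inH)) ⟩
    sum (𝟙 ∘ not ∘ inH) * lam                        ≡⟨ cong (_* lam) (sym (count≡sum (not ∘ inH))) ⟩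
    count (not ∘ inH) * lam                          ≡⟨ cong (_* lam) count-∉H≡count-∈H ⟩
    count inH * lam                                  ∎
    where
    weight∉H : ∀ g → 𝟙 (not (inH g)) * diffCount G blk g ≡ 𝟙 (not (inH g)) * lam
    weight∉H g with inH g in g∉
    ... | true  = refl
    ... | false = cong (1 *_) (IsPDF.diffs pdf g (∉H⇒≢ε g∉))

proposition5p1 : ∀ {n t} (G : FinGroup n) (blk : Fin n → Fin t) (k : Fin t → ℕ) (lam : ℕ)
                 → IsHPDF G blk k lam
                 → (inH : Fin n → Bool) → IsIndex2Subgroup G inH
                 → let s : Fin t → ℕ
                       s i = count (λ g → (g ∈B blk) i ∧ inH g)
                   in (sumFin s ≡ lam)
                      × (sumFin (λ i → 2 * s i * (k i ∸ s i)) ≡ lam ^ 2)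
proposition5p1 {n} {t} G blk k lam hpdf inH index2H = ∑s≡λ , ∑2s[k∸s]≡λ²
  where
  open IsHPDF hpdf
  open IsIndex2Subgroup index2H using (index2)
  open Index2Subgroup G index2H

  s : Fin t → ℕ
  s = blockCount blk inH

  |H|≡λ : count inH ≡ lam
  |H|≡λ = *-cancelˡ-≡ (count inH) lam 2 (trans (sym index2) hadamard)

  ∑s≡λ : sumFin s ≡ lam
  ∑s≡λ = trans (sumFin≡sum s) (trans (sum-blockCount blk inH) |H|≡λ)

  k∸s≡r : ∀ i → k i ∸ s i ≡ blockCount blk (not ∘ inH) i
  k∸s≡r i = trans (cong (_∸ s i) (sym (IsPDF.sizes pdf i))) (blockSize∸blockCount blk inH i)

  ∑2s[k∸s]≡λ² : sumFin (λ i → 2 * s i * (k i ∸ s i)) ≡ lam ^ 2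
  ∑2s[k∸s]≡λ² = begin
    sumFin (λ i → 2 * s i * (k i ∸ s i))                ≡⟨ sumFin≡sum (λ i → 2 * s i * (k i ∸ s i)) ⟩
    sum (λ i → 2 * s i * (k i ∸ s i))                   ≡⟨ sum-cong-≗ (λ i → cong (2 * s i *_) (k∸s≡r i)) ⟩
    sum (λ i → 2 * s i * blockCount blk (not ∘ inH) i)  ≡⟨ sym (∑-∉H-diffCount blk) ⟩
    sum (λ g → 𝟙 (not (inH g)) * diffCount G blk g)     ≡⟨ ∑-∉H-diffCount-PDF pdf ⟩
    count inH * lam                                     ≡⟨ cong (_* lam) |H|≡λ ⟩
    lam * lam                                           ≡⟨ cong (lam *_) (sym (*-identityʳ lam)) ⟩
    lam ^ 2                                             ∎
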